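{- Let $k\ge2$, $n\in\mathbb{N}$ and $w\in S_n$ with Lehmer code $c_w$. Then the number of inversions in $\mathcal{C}_{k,n,w}$ is \[I(k,n,w)=\binom{k}{2}\sum_{i=1}^{n}\binom{k^{(c_w)_i}}{2}k^{2n-i-2(c_w)_i-1}=\frac{k^n(k-1)}{4}\sum_{i=1}^n\left(k^{n-i}-k^{n-i-(c_w)_i}\right).\]
   Context: The infinite rooted directed $k$-ary tree has a root on layer $1$; every vertex has $k$ children, ordered left to right, on the next layer. A vertex with at least $k$ chips may fire by choosing $k$ of its labeled chips and sending the $j$th smallest to its $j$th leftmost child. Chips $0,\dots,k^n-1$ start at the root and are written in $n$-digit $k$-ary expansion (leading zeros allowed). For $w\in S_n$, the strategy $F_w$ fires, for each $i\in[n]$, each vertex $v$ on layer $i$ so that all chips on $v$ whose $w_i$th most significant digit equals $j$ go to the $(j+1)$th leftmost child of $v$ ($j=0,\dots,k-1$). $\mathcal{C}_{k,n,w}$ denotes the resulting stable configuration, written as the sequence of chips on layer $n+1$ read left to right; $I(k,n,w)$ is its number of inversions, i.e. pairs of positions $a<b$ with the entry at $a$ larger than the entry at $b$. The Lehmer code of $w=w_1\dots w_n$ is $c_w=((c_w)_1,\dots,(c_w)_n)$ where $(c_w)_i=\#\{j>i: w_j<w_i\}$. -}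

module Defs where

open import Data.Nat using (ℕ; zero; suc; _+_; _*_; _∸_; _^_; _<_; _<?_; _≟_; NonZero)
open import Data.Nat.Properties using (m^n≢0)
open import Data.Nat.ListAction using (sum)
open import Data.Nat.DivMod using (_/_; _%_)
open import Data.Nat.Combinatorics using (_C_)
open import Data.Fin using (Fin; toℕ)
open import Data.Fin.Permutation using (Permutation′; _⟨$⟩ʳ_)
open import Data.List using (List; []; _∷_; map; foldl; filter; concatMap; upTo; length; tabulate)

inversions : List ℕ → ℕ
inversions []       = 0
inversions (x ∷ xs) = length (filter (λ y → y <? x) xs) + inversions xs

-- w i, as a 1-based value in {1,…,n}, for a 0-based position i (i.e. w_{i+1})
wval : ∀ {n} → Permutation′ n → Fin n → ℕ
wval w i = suc (toℕ (w ⟨$⟩ʳ i))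

-- The d-th most significant digit (d ∈ {1,…,n}) of c in its n-digit base-k expansion.
digit : (k n : ℕ) → .{{NonZero k}} → ℕ → ℕ → ℕ
digit k n d c = ((c / (k ^ (n ∸ d))) {{m^n≢0 k (n ∸ d)}}) % k

-- Path of chip c under F_w: the 0-based child index chosen at layers 1,…,n.
-- At layer i the chip goes to the (j+1)-th leftmost child, j = w_i-th most significant digit.
path : (k n : ℕ) → .{{NonZero k}} → Permutation′ n → ℕ → List ℕ
path k n w c = tabulate (λ i → digit k n (wval w i) c)

-- Left-to-right position (0-based) on layer n+1 of the vertex reached by a path from the root.
leafPos : ℕ → List ℕ → ℕ
leafPos k = foldl (λ acc a → acc * k + a) 0

-- C_{k,n,w}: chips on layer n+1 read left to right (chips on vertex p listed in increasing order).
config : (k n : ℕ) → .{{NonZero k}} → Permutation′ n → List ℕ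
config k n w =
  concatMap (λ p → filter (λ c → leafPos k (path k n w c) ≟ p) (upTo (k ^ n))) (upTo (k ^ n))

I : (k n : ℕ) → .{{NonZero k}} → Permutation′ n → ℕ
I k n w = inversions (config k n w)

lehmer : ∀ {n} → Permutation′ n → Fin n → ℕ
lehmer {n} w i =
  length (filter (λ j → toℕ (w ⟨$⟩ʳ j) <? toℕ (w ⟨$⟩ʳ i))
                 (filter (λ j → toℕ i <? toℕ j) (tabulate {n = n} (λ j → j))))

sumFin : ∀ {n} → (Fin n → ℕ) → ℕ
sumFin f = sum (tabulate f)

formula1 : (k n : ℕ) → Permutation′ n → ℕ
formula1 k n w = (k C 2) * sumFin (λ i →
  let i₁ = suc (toℕ i) ; c = lehmer w i in
  ((k ^ c) C 2) * k ^ (2 * n ∸ i₁ ∸ 2 * c ∸ 1))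

-- Σ_i (k^{n-i} - k^{n-i-c_i}) (all exponents/differences are non-negative here)
innerSum2 : (k n : ℕ) → Permutation′ n → ℕ
innerSum2 k n w = sumFin (λ i →
  let i₁ = suc (toℕ i) ; c = lehmer w i in
  k ^ (n ∸ i₁) ∸ k ^ (n ∸ i₁ ∸ c))

open import Data.Nat using (_≤_; s≤s)
nz≥2 : ∀ {k} → 2 ≤ k → NonZero k
nz≥2 (s≤s _) = _

{-# OPTIONS --safe #-}
-- Chip c lands on the leaf whose base-k address lists the digits of c in the order w₁, …, wₙ,
-- and C_{k,n,w} lists the chips leaf by leaf in increasing order; so I(k,n,w) counts the pairs
-- of chips y < x with leaf x < leaf y.  Write a chip as (h·k + d)·K + l with K = k^(n−w₁) and
-- l < K, so that d is its digit at position w₁: the first address digit is d, and deleting it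
-- leaves a chip h·K + l whose leaf under w′ (w with w₁ removed) is the rest of the address.
-- Pairs with equal d contribute k·I(k,n−1,w′).  A pair with different d is an inversion exactly
-- when its h-parts compare oppositely to its d's, which gives C(k,2)·C(k^(w₁−1),2)·K² more.
-- As (c_w)₁ = w₁ − 1 and the Lehmer code of w′ is the tail of c_w, unrolling this recursion
-- gives the first closed form; the second follows termwise from 2·C(x,2) = x(x − 1).
module Submission where

open import Defs
open import Data.Nat using (ℕ; _*_; _^_; _∸_; _≤_)
open import Data.Fin.Permutation using (Permutation′)
open import Data.Product using (_×_; _,_)
open import Relation.Binary.PropositionalEquality using (_≡_)

open import Data.Bool using (Bool; true; false; if_then_else_)
open import Data.Nat using (zero; suc; _+_; _<_; _<ᵇ_; _≡ᵇ_; s≤s; s≤s⁻¹; z<s; s<s; NonZero)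
open import Data.Nat.Properties
open import Data.Nat.DivMod
  using (_/_; _%_; m%n<n; m*n/n≡m; m<n⇒m/n≡0; m<n⇒m%n≡m; +-distrib-/-∣ˡ; [m+kn]%n≡m%n; m/n/o≡m/[n*o]; m%[n*o]/o≡m/o%n; /-congʳ)
open import Data.Nat.Divisibility using (divides-refl)
open import Data.Nat.Combinatorics using (_C_; nC1≡n; nCk+nC[k+1]≡[n+1]C[k+1])
open import Data.Fin as Fin using (Fin; toℕ)
open import Data.Fin.Properties using (toℕ<n)
open import Data.Fin.Permutation using (_⟨$⟩ʳ_; remove; punchIn-permute)
open import Data.Empty using (⊥-elim)
open import Function using (_∘_)
import Algebra.Properties.Semiring.Sum +-*-semiring as ∑
open import Relation.Binary.PropositionalEquality using (refl; sym; trans; cong; cong₂; subst; _≢_; module ≡-Reasoning)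
open import Relation.Binary.Definitions using (tri<; tri≈; tri>)
open import Relation.Nullary using (Dec; yes; no; does)
open import Relation.Unary using (Pred; Decidable)
open import Data.List using (List; []; _∷_; _++_; [_]; map; filter; length; foldl; concatMap; upTo; applyUpTo; tabulate)
open import Data.List.Properties
  using (length-filter; length-tabulate; tabulate-cong; map-tabulate; map-++; filter-++; length-++; concatMap-++;
         ++-identityʳ; upTo-∷ʳ; filter-none)
open import Data.List.Relation.Unary.All as All using (All; []; _∷_)
import Data.List.Relation.Unary.All.Properties as All
open import Data.List.Relation.Unary.AllPairs using (AllPairs; []; _∷_)
import Data.List.Relation.Unary.AllPairs.Properties as AllPairs
open import Data.Nat.ListAction using (sum)
open import Data.Nat.ListAction.Properties using (sum-++)
open import Data.Nat.Tactic.RingSolver using (solve-∀)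
open import Algebra.Properties.CommutativeSemigroup *-commutativeSemigroup using (x∙yz≈y∙xz)
open import Algebra.Properties.CommutativeSemigroup +-commutativeSemigroup using () renaming (interchange to +-interchange)

-- Defined through _<ᵇ_ and _≡ᵇ_ so that they are definitionally the indicators of
-- does (a <? b) and does (a ≟ b), the tests that filter uses in Defs.

⟦_<_⟧ : ℕ → ℕ → ℕ
⟦ a < b ⟧ = if a <ᵇ b then 1 else 0

⟦_≡_⟧ : ℕ → ℕ → ℕ
⟦ a ≡ b ⟧ = if a ≡ᵇ b then 1 else 0

⟦<⟧≡1 : ∀ {a b} → a < b → ⟦ a < b ⟧ ≡ 1
⟦<⟧≡1 {zero}  {suc b} _       = refl
⟦<⟧≡1 {suc a} {suc b} (s≤s p) = ⟦<⟧≡1 p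

⟦<⟧≡0 : ∀ {a b} → b ≤ a → ⟦ a < b ⟧ ≡ 0
⟦<⟧≡0 {a}     {zero}  _       = refl
⟦<⟧≡0 {suc a} {suc b} (s≤s p) = ⟦<⟧≡0 p

⟦≡⟧-refl : ∀ a → ⟦ a ≡ a ⟧ ≡ 1
⟦≡⟧-refl zero    = refl
⟦≡⟧-refl (suc a) = ⟦≡⟧-refl a

⟦≡⟧≡0 : ∀ {a b} → a ≢ b → ⟦ a ≡ b ⟧ ≡ 0
⟦≡⟧≡0 {zero}  {zero}  a≢b = ⊥-elim (a≢b refl)
⟦≡⟧≡0 {zero}  {suc b} _   = refl
⟦≡⟧≡0 {suc a} {zero}  _   = refl
⟦≡⟧≡0 {suc a} {suc b} a≢b = ⟦≡⟧≡0 (a≢b ∘ cong suc)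

⟦<⟧+⟦≡⟧ : ∀ a b → ⟦ a < b ⟧ + ⟦ a ≡ b ⟧ ≡ ⟦ a < suc b ⟧
⟦<⟧+⟦≡⟧ zero    zero    = refl
⟦<⟧+⟦≡⟧ zero    (suc b) = refl
⟦<⟧+⟦≡⟧ (suc a) zero    = refl
⟦<⟧+⟦≡⟧ (suc a) (suc b) = ⟦<⟧+⟦≡⟧ a b

⟦≡⟧-subst : ∀ a b (f : ℕ → ℕ) → ⟦ a ≡ b ⟧ * f a ≡ ⟦ a ≡ b ⟧ * f b
⟦≡⟧-subst a b f with a ≟ b
... | yes refl = refl
... | no a≢b   = trans (cong (_* f a) 0≡) (cong (_* f b) (sym 0≡))
  where 0≡ = ⟦≡⟧≡0 a≢b

⟦<⟧-+ : ∀ c u v → ⟦ c + u < c + v ⟧ ≡ ⟦ u < v ⟧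
⟦<⟧-+ zero    u v = refl
⟦<⟧-+ (suc c) u v = ⟦<⟧-+ c u v

⟦≡⟧-+ : ∀ c u v → ⟦ c + u ≡ c + v ⟧ ≡ ⟦ u ≡ v ⟧
⟦≡⟧-+ zero    u v = refl
⟦≡⟧-+ (suc c) u v = ⟦≡⟧-+ c u v

m*n+o<p*n : ∀ {m n o p} → m < p → o < n → m * n + o < p * n
m*n+o<p*n {m} {n} {o} {p} m<p o<n = begin-strict
  m * n + o  <⟨ +-monoʳ-< (m * n) o<n ⟩
  m * n + n  ≡⟨ +-comm (m * n) n ⟩
  suc m * n  ≤⟨ *-monoˡ-≤ n m<p ⟩
  p * n      ∎
  where open ≤-Reasoning

lex-< : ∀ {a b u B} v → a < b → u < B → a * B + u < b * B + v
lex-< {b = b} {B = B} v a<b u<B = ≤-trans (m*n+o<p*n a<b u<B) (m≤m+n (b * B) v)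

⟦lex<⟧ : ∀ a b {u v B} → u < B → v < B →
         ⟦ a * B + u < b * B + v ⟧ ≡ ⟦ a < b ⟧ + ⟦ a ≡ b ⟧ * ⟦ u < v ⟧
⟦lex<⟧ a b {u} {v} {B} u<B v<B with <-cmp a b
... | tri< a<b _ _ rewrite ⟦<⟧≡1 (lex-< v a<b u<B) | ⟦<⟧≡1 a<b | ⟦≡⟧≡0 (<⇒≢ a<b) = refl
... | tri≈ _ refl _ rewrite ⟦<⟧-+ (a * B) u v | ⟦<⟧≡0 (≤-refl {a}) | ⟦≡⟧-refl a = sym (+-identityʳ _)
... | tri> _ _ b<a
  rewrite ⟦<⟧≡0 (<⇒≤ (lex-< u b<a v<B)) | ⟦<⟧≡0 (<⇒≤ b<a) | ⟦≡⟧≡0 (>⇒≢ b<a) = refl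

⟦lex≡⟧ : ∀ a b {u v B} → u < B → v < B → ⟦ a * B + u ≡ b * B + v ⟧ ≡ ⟦ a ≡ b ⟧ * ⟦ u ≡ v ⟧
⟦lex≡⟧ a b {u} {v} {B} u<B v<B with <-cmp a b
... | tri< a<b _ _ rewrite ⟦≡⟧≡0 (<⇒≢ (lex-< v a<b u<B)) | ⟦≡⟧≡0 (<⇒≢ a<b) = refl
... | tri≈ _ refl _ rewrite ⟦≡⟧-+ (a * B) u v | ⟦≡⟧-refl a = sym (+-identityʳ _)
... | tri> _ _ b<a rewrite ⟦≡⟧≡0 (>⇒≢ (lex-< u b<a v<B)) | ⟦≡⟧≡0 (>⇒≢ b<a) = refl

∑< : ℕ → (ℕ → ℕ) → ℕ
∑< zero    f = 0
∑< (suc n) f = f 0 + ∑< n (f ∘ suc)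

syntax ∑< n (λ i → x) = ∑[ i < n ] x

∑<-cong : ∀ n {f g : ℕ → ℕ} → (∀ i → i < n → f i ≡ g i) → ∑< n f ≡ ∑< n g
∑<-cong zero    f≡g = refl
∑<-cong (suc n) f≡g = cong₂ _+_ (f≡g 0 z<s) (∑<-cong n (λ i i<n → f≡g (suc i) (s<s i<n)))

∑<-zero : ∀ n → ∑[ _ < n ] 0 ≡ 0
∑<-zero zero    = refl
∑<-zero (suc n) = ∑<-zero n

∑<-distrib-+ : ∀ n (f g : ℕ → ℕ) → ∑[ i < n ] (f i + g i) ≡ ∑< n f + ∑< n g
∑<-distrib-+ zero    f g = refl
∑<-distrib-+ (suc n) f g = trans (cong (f 0 + g 0 +_) (∑<-distrib-+ n (f ∘ suc) (g ∘ suc)))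
                                 (+-interchange (f 0) (g 0) _ _)

∑<-comm : ∀ m n (f : ℕ → ℕ → ℕ) → ∑[ i < m ] ∑[ j < n ] f i j ≡ ∑[ j < n ] ∑[ i < m ] f i j
∑<-comm zero    n f = sym (∑<-zero n)
∑<-comm (suc m) n f = trans (cong (∑< n (f 0) +_) (∑<-comm m n (f ∘ suc)))
                            (sym (∑<-distrib-+ n (f 0) (λ j → ∑[ i < m ] f (suc i) j)))

*-distribˡ-∑< : ∀ n c (f : ℕ → ℕ) → c * ∑< n f ≡ ∑[ i < n ] (c * f i)
*-distribˡ-∑< zero    c f = *-zeroʳ c
*-distribˡ-∑< (suc n) c f = trans (*-distribˡ-+ c (f 0) _) (cong (c * f 0 +_) (*-distribˡ-∑< n c (f ∘ suc)))

*-distribʳ-∑< : ∀ n c (f : ℕ → ℕ) → ∑< n f * c ≡ ∑[ i < n ] (f i * c)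
*-distribʳ-∑< zero    c f = refl
*-distribʳ-∑< (suc n) c f = trans (*-distribʳ-+ c (f 0) _) (cong (f 0 * c +_) (*-distribʳ-∑< n c (f ∘ suc)))

∑<-product : ∀ a b (f g : ℕ → ℕ) → ∑[ i < a ] ∑[ j < b ] (f i * g j) ≡ ∑< a f * ∑< b g
∑<-product a b f g = trans (∑<-cong a (λ i _ → sym (*-distribˡ-∑< b (f i) g))) (sym (*-distribʳ-∑< a (∑< b g) f))

∑<-const : ∀ n c → ∑[ _ < n ] c ≡ n * c
∑<-const zero    c = refl
∑<-const (suc n) c = cong (c +_) (∑<-const n c)

∑<-split : ∀ a b (f : ℕ → ℕ) → ∑< (a + b) f ≡ ∑< a f + ∑[ j < b ] f (a + j)
∑<-split zero    b f = refl
∑<-split (suc a) b f = trans (cong (f 0 +_) (∑<-split a b (f ∘ suc))) (sym (+-assoc (f 0) (∑< a (f ∘ suc)) _))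

∑<-* : ∀ a b (f : ℕ → ℕ) → ∑< (a * b) f ≡ ∑[ i < a ] ∑[ j < b ] f (i * b + j)
∑<-* zero    b f = refl
∑<-* (suc a) b f = trans (∑<-split b (a * b) f) (cong (∑< b f +_) (trans (∑<-* a b (f ∘ (b +_)))
  (∑<-cong a (λ i _ → ∑<-cong b (λ j _ → cong f (sym (+-assoc b (i * b) j)))))))

∑<-⟦≡⟧ : ∀ n i (f : ℕ → ℕ) → i < n → ∑[ j < n ] (⟦ i ≡ j ⟧ * f j) ≡ f i
∑<-⟦≡⟧ (suc n) zero    f _         = trans (cong₂ _+_ (*-identityˡ (f 0)) (∑<-zero n)) (+-identityʳ (f 0))
∑<-⟦≡⟧ (suc n) (suc i) f (s≤s i<n) = ∑<-⟦≡⟧ n i (f ∘ suc) i<n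

∑<-⟦<⟧ : ∀ n a → a ≤ n → ∑[ i < n ] ⟦ i < a ⟧ ≡ a
∑<-⟦<⟧ n       zero    _       = ∑<-zero n
∑<-⟦<⟧ (suc n) (suc a) (s≤s a≤n) = cong suc (∑<-⟦<⟧ n a a≤n)

∑<-⟦>⟧ : ∀ n a → ∑[ i < n ] ⟦ a < i ⟧ ≡ n ∸ suc a
∑<-⟦>⟧ zero    a       = refl
∑<-⟦>⟧ (suc n) zero    = trans (∑<-const n 1) (*-identityʳ n)
∑<-⟦>⟧ (suc n) (suc a) = ∑<-⟦>⟧ n a

∑<-pairs : ∀ n → ∑[ i < n ] ∑[ j < n ] ⟦ i < j ⟧ ≡ n C 2
∑<-pairs zero    = refl
∑<-pairs (suc n) = begin
  ∑[ j < n ] 1 + ∑[ i < n ] ∑[ j < n ] ⟦ i < j ⟧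
                                               ≡⟨ cong₂ _+_ (trans (∑<-const n 1) (*-identityʳ n)) (∑<-pairs n) ⟩
  n + n C 2                                    ≡⟨ cong (_+ n C 2) (sym (nC1≡n n)) ⟩
  n C 1 + n C 2                                ≡⟨ nCk+nC[k+1]≡[n+1]C[k+1] n 1 ⟩
  suc n C 2                                    ∎
  where open ≡-Reasoning

𝟙 : Bool → ℕ
𝟙 b = if b then 1 else 0

module _ {a p} {A : Set a} {P : Pred A p} (P? : Decidable P) where

  length-filter≡sum : ∀ xs → length (filter P? xs) ≡ sum (map (𝟙 ∘ does ∘ P?) xs)
  length-filter≡sum []       = refl
  length-filter≡sum (x ∷ xs) with does (P? x)
  ... | true  = cong suc (length-filter≡sum xs)
  ... | false = length-filter≡sum xs

  sum-map-filter : ∀ (f : A → ℕ) xs → sum (map f (filter P? xs)) ≡ sum (map (λ x → 𝟙 (does (P? x)) * f x) xs)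
  sum-map-filter f []       = refl
  sum-map-filter f (x ∷ xs) with does (P? x)
  ... | true  = cong₂ _+_ (sym (+-identityʳ (f x))) (sum-map-filter f xs)
  ... | false = sum-map-filter f xs

sum-map-applyUpTo : ∀ n (f g : ℕ → ℕ) → sum (map f (applyUpTo g n)) ≡ ∑[ i < n ] f (g i)
sum-map-applyUpTo zero    f g = refl
sum-map-applyUpTo (suc n) f g = cong (f (g 0) +_) (sum-map-applyUpTo n f (g ∘ suc))

sum-tabulate : ∀ {n} (f : Fin n → ℕ) → sum (tabulate f) ≡ ∑.sum f
sum-tabulate {zero}  f = refl
sum-tabulate {suc n} f = cong (f Fin.zero +_) (sum-tabulate (f ∘ Fin.suc))

sum-toℕ : ∀ n (f : ℕ → ℕ) → ∑.sum {n} (f ∘ toℕ) ≡ ∑< n f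
sum-toℕ zero    f = refl
sum-toℕ (suc n) f = cong (f 0 +_) (sum-toℕ n (f ∘ suc))

-- Inversions of a bucket sort

inversions-++ : ∀ xs ys → inversions (xs ++ ys) ≡
  inversions xs + inversions ys + sum (map (λ x → sum (map (λ y → ⟦ y < x ⟧) ys)) xs)
inversions-++ []       ys = sym (+-identityʳ (inversions ys))
inversions-++ (x ∷ xs) ys = begin
  length (filter (_<? x) (xs ++ ys)) + inversions (xs ++ ys)
    ≡⟨ cong₂ _+_ (trans (cong length (filter-++ (_<? x) xs ys)) (length-++ (filter (_<? x) xs)))
                 (inversions-++ xs ys) ⟩
  (below xs + length (filter (_<? x) ys)) + (inversions xs + inversions ys + cross xs)
    ≡⟨ cong (λ b → below xs + b + (inversions xs + inversions ys + cross xs)) (length-filter≡sum (_<? x) ys) ⟩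
  (below xs + sum (map (λ y → ⟦ y < x ⟧) ys)) + (inversions xs + inversions ys + cross xs)
    ≡⟨ regroup (below xs) (sum (map (λ y → ⟦ y < x ⟧) ys)) (inversions xs) (inversions ys) (cross xs) ⟩
  (below xs + inversions xs) + inversions ys + (sum (map (λ y → ⟦ y < x ⟧) ys) + cross xs) ∎
  where
  open ≡-Reasoning
  below : List ℕ → ℕ
  below zs = length (filter (_<? x) zs)
  cross : List ℕ → ℕ
  cross zs = sum (map (λ z → sum (map (λ y → ⟦ y < z ⟧) ys)) zs)
  regroup : ∀ a b c d e → (a + b) + (c + d + e) ≡ (a + c) + d + (b + e)
  regroup = solve-∀

inversions-increasing : ∀ {xs} → AllPairs _<_ xs → inversions xs ≡ 0
inversions-increasing []                    = refl
inversions-increasing {x ∷ xs} (x<xs ∷ xs↑) =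
  cong₂ _+_ (cong length (filter-none (_<? x) (All.map (λ x<y y<x → <-asym x<y y<x) x<xs)))
            (inversions-increasing xs↑)

bucket : (ℕ → ℕ) → ℕ → ℕ → List ℕ
bucket g N p = filter (λ c → g c ≟ p) (upTo N)

bucketSort : (ℕ → ℕ) → ℕ → ℕ → List ℕ
bucketSort g N M = concatMap (bucket g N) (upTo M)

bucket-increasing : ∀ g N p → AllPairs _<_ (bucket g N p)
bucket-increasing g N p = AllPairs.filter⁺ (λ c → g c ≟ p) (AllPairs.applyUpTo⁺₁ (λ i → i) N (λ i<j _ → i<j))

bucketSort-suc : ∀ g N M → bucketSort g N (suc M) ≡ bucketSort g N M ++ bucket g N M
bucketSort-suc g N M = begin
  concatMap (bucket g N) (upTo (suc M))        ≡⟨ cong (concatMap (bucket g N)) (upTo-∷ʳ M) ⟨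
  concatMap (bucket g N) (upTo M ++ [ M ])     ≡⟨ concatMap-++ (bucket g N) (upTo M) [ M ] ⟩
  bucketSort g N M ++ (bucket g N M ++ [])     ≡⟨ cong (bucketSort g N M ++_) (++-identityʳ (bucket g N M)) ⟩
  bucketSort g N M ++ bucket g N M             ∎
  where open ≡-Reasoning

sum-map-bucket : ∀ g N p (f : ℕ → ℕ) → sum (map f (bucket g N p)) ≡ ∑[ c < N ] (⟦ g c ≡ p ⟧ * f c)
sum-map-bucket g N p f = trans (sum-map-filter (λ c → g c ≟ p) f (upTo N)) (sum-map-applyUpTo N _ (λ i → i))

sum-map-bucketSort : ∀ g N M (f : ℕ → ℕ) → sum (map f (bucketSort g N M)) ≡ ∑[ c < N ] (⟦ g c < M ⟧ * f c)
sum-map-bucketSort g N zero    f = sym (∑<-zero N)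
sum-map-bucketSort g N (suc M) f = begin
  sum (map f (bucketSort g N (suc M)))
    ≡⟨ cong (sum ∘ map f) (bucketSort-suc g N M) ⟩
  sum (map f (bucketSort g N M ++ bucket g N M))
    ≡⟨ trans (cong sum (map-++ f (bucketSort g N M) (bucket g N M))) (sum-++ (map f (bucketSort g N M)) _) ⟩
  sum (map f (bucketSort g N M)) + sum (map f (bucket g N M))
    ≡⟨ cong₂ _+_ (sum-map-bucketSort g N M f) (sum-map-bucket g N M f) ⟩
  ∑[ c < N ] (⟦ g c < M ⟧ * f c) + ∑[ c < N ] (⟦ g c ≡ M ⟧ * f c)
    ≡⟨ ∑<-distrib-+ N (λ c → ⟦ g c < M ⟧ * f c) (λ c → ⟦ g c ≡ M ⟧ * f c) ⟨
  ∑[ c < N ] (⟦ g c < M ⟧ * f c + ⟦ g c ≡ M ⟧ * f c)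
    ≡⟨ ∑<-cong N (λ c _ → trans (sym (*-distribʳ-+ (f c) ⟦ g c < M ⟧ _))
                                (cong (_* f c) (⟦<⟧+⟦≡⟧ (g c) M))) ⟩
  ∑[ c < N ] (⟦ g c < suc M ⟧ * f c)
    ∎
  where open ≡-Reasoning

⟦<suc⟧-split : ∀ a b M t →
  ⟦ b < M ⟧ * (⟦ a < b ⟧ * t) + ⟦ a < M ⟧ * (⟦ b ≡ M ⟧ * t) ≡ ⟦ b < suc M ⟧ * (⟦ a < b ⟧ * t)
⟦<suc⟧-split a b M t = begin
  ⟦ b < M ⟧ * X + ⟦ a < M ⟧ * (⟦ b ≡ M ⟧ * t)
    ≡⟨ cong (⟦ b < M ⟧ * X +_) (x∙yz≈y∙xz ⟦ a < M ⟧ ⟦ b ≡ M ⟧ t) ⟩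
  ⟦ b < M ⟧ * X + ⟦ b ≡ M ⟧ * (⟦ a < M ⟧ * t)
    ≡⟨ cong (⟦ b < M ⟧ * X +_) (⟦≡⟧-subst b M (λ z → ⟦ a < z ⟧ * t)) ⟨
  ⟦ b < M ⟧ * X + ⟦ b ≡ M ⟧ * X
    ≡⟨ *-distribʳ-+ X ⟦ b < M ⟧ ⟦ b ≡ M ⟧ ⟨
  (⟦ b < M ⟧ + ⟦ b ≡ M ⟧) * X
    ≡⟨ cong (_* X) (⟦<⟧+⟦≡⟧ b M) ⟩
  ⟦ b < suc M ⟧ * X ∎
  where
  open ≡-Reasoning
  X = ⟦ a < b ⟧ * t

inversions-bucketSort : ∀ g N M → inversions (bucketSort g N M) ≡
  ∑[ x < N ] ∑[ y < N ] (⟦ g y < M ⟧ * (⟦ g x < g y ⟧ * ⟦ y < x ⟧))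
inversions-bucketSort g N zero    = sym (trans (∑<-cong N (λ _ _ → ∑<-zero N)) (∑<-zero N))
inversions-bucketSort g N (suc M) = begin
  inversions (bucketSort g N (suc M))
    ≡⟨ cong inversions (bucketSort-suc g N M) ⟩
  inversions (bucketSort g N M ++ bucket g N M)
    ≡⟨ inversions-++ (bucketSort g N M) (bucket g N M) ⟩
  inversions (bucketSort g N M) + inversions (bucket g N M) + cross
    ≡⟨ cong₂ (λ i j → i + j + cross) (inversions-bucketSort g N M) (inversions-increasing (bucket-increasing g N M)) ⟩
  ∑[ x < N ] ∑[ y < N ] (⟦ g y < M ⟧ * T x y) + 0 + cross
    ≡⟨ cong₂ _+_ (+-identityʳ _) cross≡ ⟩
  ∑[ x < N ] ∑[ y < N ] (⟦ g y < M ⟧ * T x y)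
    + ∑[ x < N ] ∑[ y < N ] (⟦ g x < M ⟧ * (⟦ g y ≡ M ⟧ * ⟦ y < x ⟧))
    ≡⟨ ∑<-distrib-+ N _ _ ⟨
  ∑[ x < N ] (∑[ y < N ] (⟦ g y < M ⟧ * T x y) + ∑[ y < N ] (⟦ g x < M ⟧ * (⟦ g y ≡ M ⟧ * ⟦ y < x ⟧)))
    ≡⟨ ∑<-cong N (λ x _ → trans (sym (∑<-distrib-+ N _ _))
                                (∑<-cong N (λ y _ → ⟦<suc⟧-split (g x) (g y) M ⟦ y < x ⟧))) ⟩
  ∑[ x < N ] ∑[ y < N ] (⟦ g y < suc M ⟧ * T x y) ∎
  where
  open ≡-Reasoning
  T : ℕ → ℕ → ℕ
  T x y = ⟦ g x < g y ⟧ * ⟦ y < x ⟧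
  cross : ℕ
  cross = sum (map (λ x → sum (map (λ y → ⟦ y < x ⟧) (bucket g N M))) (bucketSort g N M))
  cross≡ : cross ≡ ∑[ x < N ] ∑[ y < N ] (⟦ g x < M ⟧ * (⟦ g y ≡ M ⟧ * ⟦ y < x ⟧))
  cross≡ = trans (sum-map-bucketSort g N M _) (∑<-cong N (λ x _ →
             trans (cong (⟦ g x < M ⟧ *_) (sum-map-bucket g N M (λ y → ⟦ y < x ⟧)))
                   (*-distribˡ-∑< N ⟦ g x < M ⟧ _)))

inversions-bucketSort-total : ∀ g N M → (∀ c → g c < M) → inversions (bucketSort g N M) ≡
  ∑[ x < N ] ∑[ y < N ] (⟦ g x < g y ⟧ * ⟦ y < x ⟧)
inversions-bucketSort-total g N M g<M = trans (inversions-bucketSort g N M)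
  (∑<-cong N (λ x _ → ∑<-cong N (λ y _ → trans (cong (_* _) (⟦<⟧≡1 (g<M y))) (*-identityˡ _))))

[m*n+o]/n≡m : ∀ m {n o} .{{_ : NonZero n}} → o < n → (m * n + o) / n ≡ m
[m*n+o]/n≡m m {n} {o} o<n = begin
  (m * n + o) / n    ≡⟨ +-distrib-/-∣ˡ o (divides-refl m) ⟩
  m * n / n + o / n  ≡⟨ cong₂ _+_ (m*n/n≡m m n) (m<n⇒m/n≡0 o<n) ⟩
  m + 0              ≡⟨ +-identityʳ m ⟩
  m                  ∎
  where open ≡-Reasoning

[m*n+o]%n≡o : ∀ m {n o} .{{_ : NonZero n}} → o < n → (m * n + o) % n ≡ o
[m*n+o]%n≡o m {n} {o} o<n = trans (cong (_% n) (+-comm (m * n) o)) (trans ([m+kn]%n≡m%n o m n) (m<n⇒m%n≡m o<n))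

module _ (k : ℕ) .{{_ : NonZero k}} where

  -- The digit of c of weight k ^ e; digit k n d c from Defs is dig k (n ∸ d) c.
  dig : ℕ → ℕ → ℕ
  dig e c = (c / k ^ e) {{m^n≢0 k e}} % k

  dig-+-multiple : ∀ e lo Y → dig e (lo + Y * k ^ suc e) ≡ dig e lo
  dig-+-multiple e lo Y = begin
    (lo + Y * k ^ suc e) / k ^ e % k        ≡⟨ m%[n*o]/o≡m/o%n _ k (k ^ e) ⟨
    (lo + Y * k ^ suc e) % k ^ suc e / k ^ e ≡⟨ cong (_/ k ^ e) ([m+kn]%n≡m%n lo Y (k ^ suc e)) ⟩
    lo % k ^ suc e / k ^ e                  ≡⟨ m%[n*o]/o≡m/o%n lo k (k ^ e) ⟩
    lo / k ^ e % k                          ∎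
    where
    open ≡-Reasoning
    instance
      _ = m^n≢0 k e
      _ = m^n≢0 k (suc e)

  dig-ignores-above : ∀ {e e₀} X lo → e < e₀ → dig e (X * k ^ e₀ + lo) ≡ dig e lo
  dig-ignores-above {e} {e₀} X lo e<e₀ = begin
    dig e (X * k ^ e₀ + lo)                    ≡⟨ cong (dig e) (+-comm (X * k ^ e₀) lo) ⟩
    dig e (lo + X * k ^ e₀)                    ≡⟨ cong (λ z → dig e (lo + X * z)) k^e₀≡ ⟩
    dig e (lo + X * (k ^ q * k ^ suc e))       ≡⟨ cong (λ z → dig e (lo + z)) (*-assoc X (k ^ q) _) ⟨
    dig e (lo + X * k ^ q * k ^ suc e)         ≡⟨ dig-+-multiple e lo (X * k ^ q) ⟩
    dig e lo                                   ∎
    where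
    open ≡-Reasoning
    q = e₀ ∸ suc e
    k^e₀≡ : k ^ e₀ ≡ k ^ q * k ^ suc e
    k^e₀≡ = trans (cong (k ^_) (sym (m∸n+n≡m e<e₀))) (^-distribˡ-+-* k q (suc e))

  [m*k^a+o]/k^[a+q]≡m/k^q : ∀ m {o} a q → o < k ^ a →
    ((m * k ^ a + o) / k ^ (a + q)) {{m^n≢0 k (a + q)}} ≡ (m / k ^ q) {{m^n≢0 k q}}
  [m*k^a+o]/k^[a+q]≡m/k^q m {o} a q o<k^a = begin
    (m * k ^ a + o) / k ^ (a + q)     ≡⟨ /-congʳ (^-distribˡ-+-* k a q) ⟩
    (m * k ^ a + o) / (k ^ a * k ^ q) ≡⟨ m/n/o≡m/[n*o] _ (k ^ a) (k ^ q) ⟨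
    (m * k ^ a + o) / k ^ a / k ^ q   ≡⟨ cong (_/ k ^ q) ([m*n+o]/n≡m m o<k^a) ⟩
    m / k ^ q                         ∎
    where
    open ≡-Reasoning
    instance
      _ = m^n≢0 k a
      _ = m^n≢0 k q
      _ = m^n≢0 k (a + q)
      _ = m*n≢0 (k ^ a) (k ^ q)

  dig-below-removed : ∀ {e e₀} hi d lo → e < e₀ → dig e ((hi * k + d) * k ^ e₀ + lo) ≡ dig e (hi * k ^ e₀ + lo)
  dig-below-removed hi d lo e<e₀ = trans (dig-ignores-above (hi * k + d) lo e<e₀) (sym (dig-ignores-above hi lo e<e₀))

  module _ {e₀ d lo : ℕ} (hi : ℕ) (d<k : d < k) (lo<k^e₀ : lo < k ^ e₀) where

    dig-removed : dig e₀ ((hi * k + d) * k ^ e₀ + lo) ≡ d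
    dig-removed = trans (cong (_% k) ([m*n+o]/n≡m (hi * k + d) lo<k^e₀)) ([m*n+o]%n≡o hi d<k)
      where instance _ = m^n≢0 k e₀

    dig-above-removed : ∀ {e} → e₀ ≤ e → dig (suc e) ((hi * k + d) * k ^ e₀ + lo) ≡ dig e (hi * k ^ e₀ + lo)
    dig-above-removed {e} e₀≤e = subst (λ e → dig (suc e) ((hi * k + d) * k ^ e₀ + lo) ≡ dig e (hi * k ^ e₀ + lo))
                               (m+[n∸m]≡n e₀≤e) (cong (_% k) (trans shift-c (sym shift-c′)))
      where
      q = e ∸ e₀
      regroup : ∀ h b d K l → (h * b + d) * K + l ≡ h * (b * K) + (d * K + l)
      regroup = solve-∀
      shift-c = trans (cong (λ z → (z / _) {{m^n≢0 k (suc e₀ + q)}}) (regroup hi k d (k ^ e₀) lo))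
                      ([m*k^a+o]/k^[a+q]≡m/k^q hi (suc e₀) q (m*n+o<p*n d<k lo<k^e₀))
      shift-c′ = [m*k^a+o]/k^[a+q]≡m/k^q hi e₀ q lo<k^e₀

module _ (k : ℕ) where

  foldl-leafPos : ∀ acc as → foldl (λ acc a → acc * k + a) acc as ≡ acc * k ^ length as + leafPos k as
  foldl-leafPos acc []       = sym (trans (+-identityʳ (acc * 1)) (*-identityʳ acc))
  foldl-leafPos acc (a ∷ as) = begin
    foldl _ (acc * k + a) as                       ≡⟨ foldl-leafPos (acc * k + a) as ⟩
    (acc * k + a) * K + leafPos k as               ≡⟨ regroup acc k a K (leafPos k as) ⟩
    acc * (k * K) + (a * K + leafPos k as)         ≡⟨ cong (acc * (k * K) +_) (foldl-leafPos a as) ⟨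
    acc * (k * K) + foldl _ a as                   ∎
    where
    open ≡-Reasoning
    K = k ^ length as
    regroup : ∀ x b y K z → (x * b + y) * K + z ≡ x * (b * K) + (y * K + z)
    regroup = solve-∀

  leafPos-∷ : ∀ a as → leafPos k (a ∷ as) ≡ a * k ^ length as + leafPos k as
  leafPos-∷ = foldl-leafPos

  leafPos< : ∀ {as} → All (_< k) as → leafPos k as < k ^ length as
  leafPos< {[]}     []         = z<s
  leafPos< {a ∷ as} (a<k ∷ as<k) = begin-strict
    leafPos k (a ∷ as)                    ≡⟨ leafPos-∷ a as ⟩
    a * k ^ length as + leafPos k as      <⟨ m*n+o<p*n a<k (leafPos< as<k) ⟩
    k * k ^ length as                     ∎
    where open ≤-Reasoning

leaf : (k n : ℕ) → .{{NonZero k}} → Permutation′ n → ℕ → ℕ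
leaf k n w c = leafPos k (path k n w c)

leaf<k^n : ∀ k n .{{_ : NonZero k}} (w : Permutation′ n) c → leaf k n w c < k ^ n
leaf<k^n k n w c = subst (λ l → leaf k n w c < k ^ l) (length-tabulate (λ i → digit k n (wval w i) c))
                         (leafPos< k (All.tabulate⁺ {f = λ i → digit k n (wval w i) c} (λ i → m%n<n _ k)))

leafInversions : (k n : ℕ) → .{{NonZero k}} → Permutation′ n → ℕ
leafInversions k n w = ∑[ x < k ^ n ] ∑[ y < k ^ n ] (⟦ leaf k n w x < leaf k n w y ⟧ * ⟦ y < x ⟧)

-- config k n w is, by definition, bucketSort (leaf k n w) (k ^ n) (k ^ n).
I≡leafInversions : ∀ k n .{{_ : NonZero k}} (w : Permutation′ n) → I k n w ≡ leafInversions k n w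
I≡leafInversions k n w = inversions-bucketSort-total (leaf k n w) (k ^ n) (k ^ n) (leaf<k^n k n w)

-- Removing the first layer

toℕ-punchIn-< : ∀ {n} (i : Fin (suc n)) (j : Fin n) → toℕ j < toℕ i → toℕ (Fin.punchIn i j) ≡ toℕ j
toℕ-punchIn-< (Fin.suc i) Fin.zero    _         = refl
toℕ-punchIn-< (Fin.suc i) (Fin.suc j) (s≤s j<i) = cong suc (toℕ-punchIn-< i j j<i)

toℕ-punchIn-≥ : ∀ {n} (i : Fin (suc n)) (j : Fin n) → toℕ i ≤ toℕ j → toℕ (Fin.punchIn i j) ≡ suc (toℕ j)
toℕ-punchIn-≥ Fin.zero    j           _         = refl
toℕ-punchIn-≥ (Fin.suc i) (Fin.suc j) (s≤s i≤j) = cong suc (toℕ-punchIn-≥ i j i≤j)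

m∸n≡1+[m∸[1+n]] : ∀ {m n} → n < m → m ∸ n ≡ suc (m ∸ suc n)
m∸n≡1+[m∸[1+n]] {suc m} {zero}  _         = refl
m∸n≡1+[m∸[1+n]] {suc m} {suc n} (s≤s n<m) = m∸n≡1+[m∸[1+n]] n<m

first-digit-cases : ∀ a b G H E L →
  (⟦ a < b ⟧ + ⟦ a ≡ b ⟧ * G) * ((H + E * ⟦ b < a ⟧) + E * ⟦ b ≡ a ⟧ * L)
  ≡ ⟦ a ≡ b ⟧ * (G * (H + E * L)) + H * ⟦ a < b ⟧
first-digit-cases a b G H E L with <-cmp a b
... | tri< a<b _ _
  rewrite ⟦<⟧≡1 a<b | ⟦≡⟧≡0 (<⇒≢ a<b) | ⟦<⟧≡0 (<⇒≤ a<b) | ⟦≡⟧≡0 (>⇒≢ a<b) = first G H E L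
  where
  first : ∀ G H E L → (1 + 0 * G) * ((H + E * 0) + E * 0 * L) ≡ 0 * (G * (H + E * L)) + H * 1
  first = solve-∀
... | tri≈ _ refl _ rewrite ⟦<⟧≡0 (≤-refl {a}) | ⟦≡⟧-refl a = equal G H E L
  where
  equal : ∀ G H E L → (0 + 1 * G) * ((H + E * 0) + E * 1 * L) ≡ 1 * (G * (H + E * L)) + H * 0
  equal = solve-∀
... | tri> _ _ b<a rewrite ⟦<⟧≡0 (<⇒≤ b<a) | ⟦≡⟧≡0 (>⇒≢ b<a) = sym (*-zeroʳ H)

module FirstLayer (k : ℕ) .{{_ : NonZero k}} {n} (w : Permutation′ (suc n)) where

  w′ : Permutation′ n
  w′ = remove Fin.zero w

  -- The first layer reads the digit of weight k ^ e₀, at 0-based position m from the left.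
  m e₀ : ℕ
  m  = toℕ (w ⟨$⟩ʳ Fin.zero)
  e₀ = n ∸ m

  toℕ-w-suc : ∀ j → toℕ (w ⟨$⟩ʳ Fin.suc j) ≡ toℕ (Fin.punchIn (w ⟨$⟩ʳ Fin.zero) (w′ ⟨$⟩ʳ j))
  toℕ-w-suc j = cong toℕ (punchIn-permute w Fin.zero j)

  module _ {hi d lo : ℕ} (d<k : d < k) (lo<k^e₀ : lo < k ^ e₀) where

    private
      c c′ : ℕ
      c  = (hi * k + d) * k ^ e₀ + lo
      c′ = hi * k ^ e₀ + lo

    digit-suc : ∀ j → digit k (suc n) (wval w (Fin.suc j)) c ≡ digit k n (wval w′ j) c′
    digit-suc j with toℕ (w′ ⟨$⟩ʳ j) <? m
    ... | yes t<m = begin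
      dig k (n ∸ toℕ (w ⟨$⟩ʳ Fin.suc j)) c
        ≡⟨ cong (λ z → dig k (n ∸ z) c) (trans (toℕ-w-suc j) (toℕ-punchIn-< _ _ t<m)) ⟩
      dig k (n ∸ t) c
        ≡⟨ cong (λ e → dig k e c) (m∸n≡1+[m∸[1+n]] (toℕ<n (w′ ⟨$⟩ʳ j))) ⟩
      dig k (suc (n ∸ suc t)) c
        ≡⟨ dig-above-removed k hi d<k lo<k^e₀ (∸-monoʳ-≤ n t<m) ⟩
      dig k (n ∸ suc t) c′ ∎
      where
      open ≡-Reasoning
      t = toℕ (w′ ⟨$⟩ʳ j)
    ... | no t≮m = begin
      dig k (n ∸ toℕ (w ⟨$⟩ʳ Fin.suc j)) c
        ≡⟨ cong (λ z → dig k (n ∸ z) c) (trans (toℕ-w-suc j) (toℕ-punchIn-≥ _ _ (≮⇒≥ t≮m))) ⟩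
      dig k (n ∸ suc t) c
        ≡⟨ dig-below-removed k hi d lo (∸-monoʳ-< (s≤s (≮⇒≥ t≮m)) (toℕ<n (w′ ⟨$⟩ʳ j))) ⟩
      dig k (n ∸ suc t) c′ ∎
      where
      open ≡-Reasoning
      t = toℕ (w′ ⟨$⟩ʳ j)

    leaf-suc : leaf k (suc n) w ((hi * k + d) * k ^ e₀ + lo) ≡ d * k ^ n + leaf k n w′ (hi * k ^ e₀ + lo)
    leaf-suc = begin
      leafPos k (path k (suc n) w c)                 ≡⟨ leafPos-∷ k (dig k e₀ c) tail ⟩
      dig k e₀ c * k ^ length tail + leafPos k tail  ≡⟨ cong₂ (λ a l → a * k ^ l + leafPos k tail)
                                                              (dig-removed k {e₀} hi d<k lo<k^e₀) (length-tabulate digits) ⟩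
      d * k ^ n + leafPos k tail                     ≡⟨ cong (λ p → d * k ^ n + leafPos k p) (tabulate-cong digit-suc) ⟩
      d * k ^ n + leaf k n w′ c′                     ∎
      where
      open ≡-Reasoning
      digits : Fin n → ℕ
      digits j = digit k (suc n) (wval w (Fin.suc j)) c
      tail = tabulate digits

  A K : ℕ
  A = k ^ m
  K = k ^ e₀

  k^n≡A*K : k ^ n ≡ A * K
  k^n≡A*K = trans (cong (k ^_) (sym (m+[n∸m]≡n (s≤s⁻¹ (toℕ<n (w ⟨$⟩ʳ Fin.zero)))))) (^-distribˡ-+-* k m e₀)

  ∑-chips : ∀ F → ∑< (k ^ n) F ≡ ∑[ h < A ] ∑[ l < K ] F (h * K + l)
  ∑-chips F = trans (cong (λ N → ∑< N F) k^n≡A*K) (∑<-* A K F)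

  ∑-chips-suc : ∀ F → ∑< (k ^ suc n) F ≡ ∑[ h < A ] ∑[ d < k ] ∑[ l < K ] F ((h * k + d) * K + l)
  ∑-chips-suc F = begin
    ∑< (k * k ^ n) F   ≡⟨ cong (λ N → ∑< N F) (trans (cong (k *_) k^n≡A*K) (x∙yz≈y∙xz k A K)) ⟩
    ∑< (A * (k * K)) F ≡⟨ cong (λ N → ∑< N F) (sym (*-assoc A k K)) ⟩
    ∑< (A * k * K) F   ≡⟨ trans (∑<-* (A * k) K F) (∑<-* A k _) ⟩
    ∑[ h < A ] ∑[ d < k ] ∑[ l < K ] F ((h * k + d) * K + l) ∎
    where open ≡-Reasoning

  leaf′ : ℕ → ℕ
  leaf′ = leaf k n w′

  T′ : ℕ → ℕ → ℕ
  T′ x y = ⟦ leaf′ x < leaf′ y ⟧ * ⟦ y < x ⟧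

  pair-term : ∀ {hx dx lx hy dy ly} → dx < k → lx < K → dy < k → ly < K →
    ⟦ leaf k (suc n) w ((hx * k + dx) * K + lx) < leaf k (suc n) w ((hy * k + dy) * K + ly) ⟧
      * ⟦ (hy * k + dy) * K + ly < (hx * k + dx) * K + lx ⟧
    ≡ ⟦ dx ≡ dy ⟧ * T′ (hx * K + lx) (hy * K + ly) + ⟦ hy < hx ⟧ * ⟦ dx < dy ⟧
  pair-term {hx} {dx} {lx} {hy} {dy} {ly} dx<k lx<K dy<k ly<K = begin
    ⟦ leaf k (suc n) w x < leaf k (suc n) w y ⟧ * ⟦ y < x ⟧
      ≡⟨ cong₂ (λ a b → ⟦ a < b ⟧ * ⟦ y < x ⟧) (leaf-suc {hx} dx<k lx<K) (leaf-suc {hy} dy<k ly<K) ⟩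
    ⟦ dx * k ^ n + leaf′ x′ < dy * k ^ n + leaf′ y′ ⟧ * ⟦ y < x ⟧
      ≡⟨ cong₂ _*_ (⟦lex<⟧ dx dy (leaf<k^n k n w′ x′) (leaf<k^n k n w′ y′))
                   (⟦lex<⟧ (hy * k + dy) (hx * k + dx) ly<K lx<K) ⟩
    (⟦ dx < dy ⟧ + ⟦ dx ≡ dy ⟧ * G) * (⟦ hy * k + dy < hx * k + dx ⟧ + ⟦ hy * k + dy ≡ hx * k + dx ⟧ * L)
      ≡⟨ cong (λ z → (⟦ dx < dy ⟧ + ⟦ dx ≡ dy ⟧ * G) * z)
              (cong₂ (λ a b → a + b * L) (⟦lex<⟧ hy hx dy<k dx<k) (⟦lex≡⟧ hy hx dy<k dx<k)) ⟩
    (⟦ dx < dy ⟧ + ⟦ dx ≡ dy ⟧ * G) * ((H + E * ⟦ dy < dx ⟧) + E * ⟦ dy ≡ dx ⟧ * L)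
      ≡⟨ first-digit-cases dx dy G H E L ⟩
    ⟦ dx ≡ dy ⟧ * (G * (H + E * L)) + H * ⟦ dx < dy ⟧
      ≡⟨ cong (λ z → ⟦ dx ≡ dy ⟧ * (G * z) + H * ⟦ dx < dy ⟧) (⟦lex<⟧ hy hx ly<K lx<K) ⟨
    ⟦ dx ≡ dy ⟧ * T′ x′ y′ + H * ⟦ dx < dy ⟧ ∎
    where
    open ≡-Reasoning
    x = (hx * k + dx) * K + lx
    y = (hy * k + dy) * K + ly
    x′ = hx * K + lx
    y′ = hy * K + ly
    G = ⟦ leaf′ x′ < leaf′ y′ ⟧
    H = ⟦ hy < hx ⟧
    E = ⟦ hy ≡ hx ⟧
    L = ⟦ ly < lx ⟧

  ∑³ : (ℕ → ℕ → ℕ → ℕ) → ℕ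
  ∑³ F = ∑[ h < A ] ∑[ d < k ] ∑[ l < K ] F h d l

  ∑³-cong : ∀ {F G} → (∀ h d l → h < A → d < k → l < K → F h d l ≡ G h d l) → ∑³ F ≡ ∑³ G
  ∑³-cong F≡G = ∑<-cong A (λ h h<A → ∑<-cong k (λ d d<k → ∑<-cong K (λ l l<K → F≡G h d l h<A d<k l<K)))

  ∑³-distrib-+ : ∀ F G → ∑³ (λ h d l → F h d l + G h d l) ≡ ∑³ F + ∑³ G
  ∑³-distrib-+ F G = trans (∑<-cong A (λ h _ → trans (∑<-cong k (λ d _ → ∑<-distrib-+ K (F h d) (G h d)))
                                                      (∑<-distrib-+ k _ _)))
                           (∑<-distrib-+ A _ _)

  ∑³-separable : ∀ u v → ∑³ (λ h d _ → u h * v d) ≡ ∑< A u * (K * ∑< k v)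
  ∑³-separable u v = begin
    ∑[ h < A ] ∑[ d < k ] ∑[ _ < K ] (u h * v d) ≡⟨ ∑<-cong A (λ h _ → ∑<-cong k (λ d _ →
                                                      trans (∑<-const K _) (x∙yz≈y∙xz K (u h) (v d)))) ⟩
    ∑[ h < A ] ∑[ d < k ] (u h * (K * v d))      ≡⟨ ∑<-product A k u (λ d → K * v d) ⟩
    ∑< A u * ∑[ d < k ] (K * v d)                ≡⟨ cong (∑< A u *_) (*-distribˡ-∑< k K v) ⟨
    ∑< A u * (K * ∑< k v)                        ∎
    where open ≡-Reasoning

  same-first-digit : ∑³ (λ hx dx lx → ∑³ (λ hy dy ly → ⟦ dx ≡ dy ⟧ * T′ (hx * K + lx) (hy * K + ly)))
                   ≡ k * leafInversions k n w′
  same-first-digit = begin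
    ∑³ (λ hx dx lx → ∑³ (λ hy dy ly → ⟦ dx ≡ dy ⟧ * T′ (hx * K + lx) (hy * K + ly)))
      ≡⟨ ∑³-cong (λ hx dx lx _ dx<k _ → inner (hx * K + lx) dx<k) ⟩
    ∑[ hx < A ] ∑[ _ < k ] ∑[ lx < K ] R (hx * K + lx)
      ≡⟨ ∑<-cong A (λ hx _ → ∑<-const k _) ⟩
    ∑[ hx < A ] (k * ∑[ lx < K ] R (hx * K + lx))
      ≡⟨ *-distribˡ-∑< A k _ ⟨
    k * ∑[ hx < A ] ∑[ lx < K ] R (hx * K + lx)
      ≡⟨ cong (k *_) (∑-chips R) ⟨
    k * leafInversions k n w′ ∎
    where
    open ≡-Reasoning
    R : ℕ → ℕ
    R x = ∑[ y < k ^ n ] T′ x y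
    inner : ∀ x {dx} → dx < k → ∑³ (λ hy dy ly → ⟦ dx ≡ dy ⟧ * T′ x (hy * K + ly)) ≡ R x
    inner x {dx} dx<k = begin
      ∑[ hy < A ] ∑[ dy < k ] ∑[ ly < K ] (⟦ dx ≡ dy ⟧ * T′ x (hy * K + ly))
        ≡⟨ ∑<-cong A (λ hy _ → ∑<-cong k (λ dy _ → *-distribˡ-∑< K ⟦ dx ≡ dy ⟧ _)) ⟨
      ∑[ hy < A ] ∑[ dy < k ] (⟦ dx ≡ dy ⟧ * ∑[ ly < K ] T′ x (hy * K + ly))
        ≡⟨ ∑<-cong A (λ hy _ → ∑<-⟦≡⟧ k dx _ dx<k) ⟩
      ∑[ hy < A ] ∑[ ly < K ] T′ x (hy * K + ly)
        ≡⟨ ∑-chips (T′ x) ⟨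
      R x ∎

  different-first-digit : ∑³ (λ hx dx lx → ∑³ (λ hy dy ly → ⟦ hy < hx ⟧ * ⟦ dx < dy ⟧))
                        ≡ (A C 2) * (K * (K * (k C 2)))
  different-first-digit = begin
    ∑³ (λ hx dx lx → ∑³ (λ hy dy ly → ⟦ hy < hx ⟧ * ⟦ dx < dy ⟧))
      ≡⟨ ∑³-cong (λ hx dx _ _ _ _ → ∑³-separable (λ hy → ⟦ hy < hx ⟧) (λ dy → ⟦ dx < dy ⟧)) ⟩
    ∑³ (λ hx dx _ → U hx * (K * V dx))
      ≡⟨ ∑³-separable U (λ dx → K * V dx) ⟩
    ∑< A U * (K * ∑[ dx < k ] (K * V dx))
      ≡⟨ cong₂ (λ a b → a * (K * b)) (trans (∑<-comm A A _) (∑<-pairs A)) (sym (*-distribˡ-∑< k K V)) ⟩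
    (A C 2) * (K * (K * ∑< k V))
      ≡⟨ cong (λ z → (A C 2) * (K * (K * z))) (∑<-pairs k) ⟩
    (A C 2) * (K * (K * (k C 2))) ∎
    where
    open ≡-Reasoning
    U V : ℕ → ℕ
    U hx = ∑[ hy < A ] ⟦ hy < hx ⟧
    V dx = ∑[ dy < k ] ⟦ dx < dy ⟧

  leafInversions-suc : leafInversions k (suc n) w ≡ k * leafInversions k n w′ + (A C 2) * (K * (K * (k C 2)))
  leafInversions-suc = begin
    ∑[ x < k ^ suc n ] ∑[ y < k ^ suc n ] Φ x y
      ≡⟨ ∑-chips-suc _ ⟩
    ∑³ (λ hx dx lx → ∑[ y < k ^ suc n ] Φ (φ hx dx lx) y)
      ≡⟨ ∑³-cong (λ _ _ _ _ _ _ → ∑-chips-suc _) ⟩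
    ∑³ (λ hx dx lx → ∑³ (λ hy dy ly → Φ (φ hx dx lx) (φ hy dy ly)))
      ≡⟨ ∑³-cong (λ hx _ _ _ dx<k lx<K → ∑³-cong (λ hy _ _ _ dy<k ly<K →
           pair-term {hx} {hy = hy} dx<k lx<K dy<k ly<K)) ⟩
    ∑³ (λ hx dx lx → ∑³ (λ hy dy ly →
      ⟦ dx ≡ dy ⟧ * T′ (hx * K + lx) (hy * K + ly) + ⟦ hy < hx ⟧ * ⟦ dx < dy ⟧))
      ≡⟨ trans (∑³-cong (λ _ _ _ _ _ _ → ∑³-distrib-+ _ _)) (∑³-distrib-+ _ _) ⟩
    ∑³ (λ hx dx lx → ∑³ (λ hy dy ly → ⟦ dx ≡ dy ⟧ * T′ (hx * K + lx) (hy * K + ly)))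
      + ∑³ (λ hx dx lx → ∑³ (λ hy dy ly → ⟦ hy < hx ⟧ * ⟦ dx < dy ⟧))
      ≡⟨ cong₂ _+_ same-first-digit different-first-digit ⟩
    k * leafInversions k n w′ + (A C 2) * (K * (K * (k C 2))) ∎
    where
    open ≡-Reasoning
    Φ : ℕ → ℕ → ℕ
    Φ x y = ⟦ leaf k (suc n) w x < leaf k (suc n) w y ⟧ * ⟦ y < x ⟧
    φ : ℕ → ℕ → ℕ → ℕ
    φ h d l = (h * k + d) * K + l

⟦<⟧-punchIn : ∀ {n} (p : Fin (suc n)) (a b : Fin n) →
              ⟦ toℕ (Fin.punchIn p a) < toℕ (Fin.punchIn p b) ⟧ ≡ ⟦ toℕ a < toℕ b ⟧
⟦<⟧-punchIn Fin.zero    a           b           = refl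
⟦<⟧-punchIn (Fin.suc p) Fin.zero    Fin.zero    = refl
⟦<⟧-punchIn (Fin.suc p) Fin.zero    (Fin.suc b) = refl
⟦<⟧-punchIn (Fin.suc p) (Fin.suc a) Fin.zero    = refl
⟦<⟧-punchIn (Fin.suc p) (Fin.suc a) (Fin.suc b) = ⟦<⟧-punchIn p a b

module _ {n} (w : Permutation′ n) (i : Fin n) where

  private
    later? : (j : Fin n) → Dec (toℕ i < toℕ j)
    later? j = toℕ i <? toℕ j
    smaller? : (j : Fin n) → Dec (toℕ (w ⟨$⟩ʳ j) < toℕ (w ⟨$⟩ʳ i))
    smaller? j = toℕ (w ⟨$⟩ʳ j) <? toℕ (w ⟨$⟩ʳ i)
    positions : List (Fin n)
    positions = tabulate (λ j → j)
    inverted later : Fin n → ℕ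
    inverted j = ⟦ toℕ i < toℕ j ⟧ * ⟦ toℕ (w ⟨$⟩ʳ j) < toℕ (w ⟨$⟩ʳ i) ⟧
    later j = ⟦ toℕ i < toℕ j ⟧

  lehmer≡sum : lehmer w i ≡ ∑.sum {n} (λ j → ⟦ toℕ i < toℕ j ⟧ * ⟦ toℕ (w ⟨$⟩ʳ j) < toℕ (w ⟨$⟩ʳ i) ⟧)
  lehmer≡sum = begin
    length (filter smaller? (filter later? positions))
      ≡⟨ length-filter≡sum smaller? (filter later? positions) ⟩
    sum (map (𝟙 ∘ does ∘ smaller?) (filter later? positions))
      ≡⟨ sum-map-filter later? _ positions ⟩
    sum (map (λ j → ⟦ toℕ i < toℕ j ⟧ * ⟦ toℕ (w ⟨$⟩ʳ j) < toℕ (w ⟨$⟩ʳ i) ⟧) positions)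
      ≡⟨ cong sum (map-tabulate (λ j → j) inverted) ⟩
    sum (tabulate inverted)
      ≡⟨ sum-tabulate inverted ⟩
    ∑.sum (λ j → ⟦ toℕ i < toℕ j ⟧ * ⟦ toℕ (w ⟨$⟩ʳ j) < toℕ (w ⟨$⟩ʳ i) ⟧) ∎
    where open ≡-Reasoning

  lehmer≤ : lehmer w i ≤ n ∸ suc (toℕ i)
  lehmer≤ = begin
    lehmer w i                                     ≤⟨ length-filter smaller? (filter later? positions) ⟩
    length (filter later? positions)               ≡⟨ length-filter≡sum later? positions ⟩
    sum (map later positions)                      ≡⟨ cong sum (map-tabulate (λ j → j) later) ⟩
    sum (tabulate later)                           ≡⟨ trans (sum-tabulate later) (sum-toℕ n (λ j → ⟦ toℕ i < j ⟧)) ⟩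
    ∑[ j < n ] ⟦ toℕ i < j ⟧                      ≡⟨ ∑<-⟦>⟧ n (toℕ i) ⟩
    n ∸ suc (toℕ i)                                ∎
    where open ≤-Reasoning

module _ {n} (w : Permutation′ (suc n)) where

  lehmer-zero : lehmer w Fin.zero ≡ toℕ (w ⟨$⟩ʳ Fin.zero)
  lehmer-zero = begin
    lehmer w Fin.zero
      ≡⟨ lehmer≡sum w Fin.zero ⟩
    0 + ∑.sum {n} (λ j → 1 * ⟦ toℕ (w ⟨$⟩ʳ Fin.suc j) < a ⟧)
      ≡⟨ cong₂ _+_ (sym (⟦<⟧≡0 (≤-refl {a})))
                   (∑.sum-cong-≗ {n} (λ j → *-identityˡ ⟦ toℕ (w ⟨$⟩ʳ Fin.suc j) < a ⟧)) ⟩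
    ∑.sum {suc n} (λ j → ⟦ toℕ (w ⟨$⟩ʳ j) < a ⟧)
      ≡⟨ ∑.∑-permute (λ v → ⟦ toℕ v < a ⟧) w ⟨
    ∑.sum {suc n} (λ v → ⟦ toℕ v < a ⟧)
      ≡⟨ sum-toℕ (suc n) (λ v → ⟦ v < a ⟧) ⟩
    ∑[ v < suc n ] ⟦ v < a ⟧
      ≡⟨ ∑<-⟦<⟧ (suc n) a (<⇒≤ (toℕ<n (w ⟨$⟩ʳ Fin.zero))) ⟩
    a ∎
    where
    open ≡-Reasoning
    a = toℕ (w ⟨$⟩ʳ Fin.zero)

  lehmer-suc : ∀ i → lehmer w (Fin.suc i) ≡ lehmer (remove Fin.zero w) i
  lehmer-suc i = begin
    lehmer w (Fin.suc i)
      ≡⟨ lehmer≡sum w (Fin.suc i) ⟩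
    ∑.sum {n} (λ j → ⟦ toℕ i < toℕ j ⟧ * ⟦ toℕ (w ⟨$⟩ʳ Fin.suc j) < toℕ (w ⟨$⟩ʳ Fin.suc i) ⟧)
      ≡⟨ ∑.sum-cong-≗ {n} (λ j → cong (⟦ toℕ i < toℕ j ⟧ *_) (trans
           (cong₂ (λ a b → ⟦ toℕ a < toℕ b ⟧) (punchIn-permute w Fin.zero j) (punchIn-permute w Fin.zero i))
           (⟦<⟧-punchIn (w ⟨$⟩ʳ Fin.zero) _ _))) ⟩
    ∑.sum {n} (λ j → ⟦ toℕ i < toℕ j ⟧ * ⟦ toℕ (w′ ⟨$⟩ʳ j) < toℕ (w′ ⟨$⟩ʳ i) ⟧)
      ≡⟨ lehmer≡sum w′ i ⟨
    lehmer w′ i ∎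
    where
    open ≡-Reasoning
    w′ = remove Fin.zero w

2*nC2≡n*[n∸1] : ∀ n → 2 * (n C 2) ≡ n * (n ∸ 1)
2*nC2≡n*[n∸1] zero    = refl
2*nC2≡n*[n∸1] (suc n) = begin
  2 * (suc n C 2)        ≡⟨ cong (2 *_) (nCk+nC[k+1]≡[n+1]C[k+1] n 1) ⟨
  2 * (n C 1 + n C 2)    ≡⟨ cong (λ z → 2 * (z + n C 2)) (nC1≡n n) ⟩
  2 * (n + n C 2)        ≡⟨ *-distribˡ-+ 2 n (n C 2) ⟩
  2 * n + 2 * (n C 2)    ≡⟨ cong (2 * n +_) (2*nC2≡n*[n∸1] n) ⟩
  2 * n + n * (n ∸ 1)    ≡⟨ lemma n ⟩
  suc n * n              ∎
  where
  open ≡-Reasoning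
  lemma : ∀ n → 2 * n + n * (n ∸ 1) ≡ suc n * n
  lemma zero    = refl
  lemma (suc n) = ring n
    where
    ring : ∀ n → 2 * suc n + suc n * n ≡ suc (suc n) * suc n
    ring = solve-∀

sum-tabulate-* : ∀ {n} c (f : Fin n → ℕ) → sum (tabulate (λ i → c * f i)) ≡ c * sum (tabulate f)
sum-tabulate-* c f = trans (sum-tabulate (λ i → c * f i))
                           (trans (sym (∑.*-distribˡ-sum c f)) (cong (c *_) (sym (sum-tabulate f))))

exponent : ∀ t c r → 2 * (suc t + c + r) ∸ suc t ∸ 2 * c ∸ 1 ≡ t + (r + r)
exponent t c r = begin
  2 * (suc t + c + r) ∸ suc t ∸ 2 * c ∸ 1                   ≡⟨ cong (λ z → z ∸ suc t ∸ 2 * c ∸ 1) (expand t c r) ⟩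
  suc t + (2 * c + suc (t + (r + r))) ∸ suc t ∸ 2 * c ∸ 1   ≡⟨ cong (λ z → z ∸ 2 * c ∸ 1) (m+n∸m≡n (suc t) _) ⟩
  2 * c + suc (t + (r + r)) ∸ 2 * c ∸ 1                     ≡⟨ cong (_∸ 1) (m+n∸m≡n (2 * c) _) ⟩
  t + (r + r)                                               ∎
  where
  open ≡-Reasoning
  expand : ∀ t c r → 2 * (suc t + c + r) ≡ suc t + (2 * c + suc (t + (r + r)))
  expand = solve-∀

lehmer-split : ∀ {n} (w : Permutation′ n) i → n ≡ suc (toℕ i) + lehmer w i + (n ∸ suc (toℕ i) ∸ lehmer w i)
lehmer-split {n} w i = begin
  n                                    ≡⟨ m+[n∸m]≡n (toℕ<n i) ⟨
  suc t + (n ∸ suc t)                  ≡⟨ cong (suc t +_) (m+[n∸m]≡n (lehmer≤ w i)) ⟨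
  suc t + (c + (n ∸ suc t ∸ c))        ≡⟨ +-assoc (suc t) c _ ⟨
  suc t + c + (n ∸ suc t ∸ c)          ∎
  where
  open ≡-Reasoning
  t = toℕ i
  c = lehmer w i

module _ (k : ℕ) where

  term : ∀ {n} → Permutation′ n → Fin n → ℕ
  term {n} w i = ((k ^ lehmer w i) C 2) * k ^ (2 * n ∸ suc (toℕ i) ∸ 2 * lehmer w i ∸ 1)

  term-shape : ∀ {n} (w : Permutation′ n) i →
    let r = n ∸ suc (toℕ i) ∸ lehmer w i in term w i ≡ ((k ^ lehmer w i) C 2) * k ^ (toℕ i + (r + r))
  term-shape {n} w i = begin
    ((k ^ c) C 2) * k ^ (2 * n ∸ suc t ∸ 2 * c ∸ 1)
      ≡⟨ cong (λ N → ((k ^ c) C 2) * k ^ (2 * N ∸ suc t ∸ 2 * c ∸ 1)) (lehmer-split w i) ⟩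
    ((k ^ c) C 2) * k ^ (2 * (suc t + c + r) ∸ suc t ∸ 2 * c ∸ 1)
      ≡⟨ cong (λ e → ((k ^ c) C 2) * k ^ e) (exponent t c r) ⟩
    ((k ^ c) C 2) * k ^ (t + (r + r)) ∎
    where
    open ≡-Reasoning
    t = toℕ i
    c = lehmer w i
    r = n ∸ suc t ∸ c

  module _ {n} (w : Permutation′ (suc n)) where

    private
      m = toℕ (w ⟨$⟩ʳ Fin.zero)
      w′ = remove Fin.zero w

    term-zero : term w Fin.zero ≡ ((k ^ m) C 2) * (k ^ (n ∸ m) * k ^ (n ∸ m))
    term-zero = trans (term-shape w Fin.zero)
      (trans (cong (λ c → ((k ^ c) C 2) * k ^ ((n ∸ c) + (n ∸ c))) (lehmer-zero w))
             (cong (((k ^ m) C 2) *_) (^-distribˡ-+-* k (n ∸ m) (n ∸ m))))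

    term-suc : ∀ j → term w (Fin.suc j) ≡ k * term w′ j
    term-suc j = begin
      term w (Fin.suc j)
        ≡⟨ term-shape w (Fin.suc j) ⟩
      ((k ^ lehmer w (Fin.suc j)) C 2) * k ^ (suc t + (r (lehmer w (Fin.suc j)) + r (lehmer w (Fin.suc j))))
        ≡⟨ cong (λ c → ((k ^ c) C 2) * k ^ (suc t + (r c + r c))) (lehmer-suc w j) ⟩
      ((k ^ c′) C 2) * (k * k ^ (t + (r c′ + r c′)))
        ≡⟨ x∙yz≈y∙xz ((k ^ c′) C 2) k _ ⟩
      k * (((k ^ c′) C 2) * k ^ (t + (r c′ + r c′)))
        ≡⟨ cong (k *_) (term-shape w′ j) ⟨
      k * term w′ j ∎
      where
      open ≡-Reasoning
      t = toℕ j
      c′ = lehmer w′ j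
      r : ℕ → ℕ
      r c = n ∸ suc t ∸ c

    sum-term-suc : sum (tabulate (term w)) ≡ ((k ^ m) C 2) * (k ^ (n ∸ m) * k ^ (n ∸ m)) + k * sum (tabulate (term w′))
    sum-term-suc = cong₂ _+_ term-zero (trans (cong sum (tabulate-cong term-suc)) (sum-tabulate-* k (term w′)))

  4*kC2*term : ∀ {n} (w : Permutation′ n) i →
    4 * (k C 2) * term w i ≡ k ^ n * (k ∸ 1) * (k ^ (n ∸ suc (toℕ i)) ∸ k ^ (n ∸ suc (toℕ i) ∸ lehmer w i))
  4*kC2*term {n} w i = begin
    4 * (k C 2) * term w i
      ≡⟨ cong (4 * (k C 2) *_) (term-shape w i) ⟩
    4 * (k C 2) * (((k ^ c) C 2) * k ^ (t + (r + r)))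
      ≡⟨ double-both (k C 2) ((k ^ c) C 2) _ ⟩
    2 * (k C 2) * (2 * ((k ^ c) C 2)) * k ^ (t + (r + r))
      ≡⟨ cong₂ (λ a b → a * b * k ^ (t + (r + r))) (2*nC2≡n*[n∸1] k) (2*nC2≡n*[n∸1] (k ^ c)) ⟩
    k * (k ∸ 1) * (k ^ c * (k ^ c ∸ 1)) * k ^ (t + (r + r))
      ≡⟨ cong (k * (k ∸ 1) * (k ^ c * (k ^ c ∸ 1)) *_)
              (trans (^-distribˡ-+-* k t (r + r)) (cong (k ^ t *_) (^-distribˡ-+-* k r r))) ⟩
    k * (k ∸ 1) * (k ^ c * (k ^ c ∸ 1)) * (k ^ t * (k ^ r * k ^ r))
      ≡⟨ regroup k (k ∸ 1) (k ^ c) (k ^ c ∸ 1) (k ^ t) (k ^ r) ⟩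
    k * (k ^ t * k ^ c * k ^ r) * (k ∸ 1) * ((k ^ c ∸ 1) * k ^ r)
      ≡⟨ cong₂ (λ a b → a * (k ∸ 1) * b) k^[1+t+c+r] k^[c+r]∸k^r ⟨
    k ^ (suc t + c + r) * (k ∸ 1) * (k ^ (c + r) ∸ k ^ r)
      ≡⟨ cong₂ (λ N e → k ^ N * (k ∸ 1) * (k ^ e ∸ k ^ r))
               (lehmer-split w i) (sym (m+[n∸m]≡n (lehmer≤ w i))) ⟨
    k ^ n * (k ∸ 1) * (k ^ (n ∸ suc t) ∸ k ^ r) ∎
    where
    open ≡-Reasoning
    t = toℕ i
    c = lehmer w i
    r = n ∸ suc t ∸ c
    double-both : ∀ a b z → 4 * a * (b * z) ≡ 2 * a * (2 * b) * z
    double-both = solve-∀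
    regroup : ∀ k km K Km kt kr → k * km * (K * Km) * (kt * (kr * kr)) ≡ k * (kt * K * kr) * km * (Km * kr)
    regroup = solve-∀
    k^[1+t+c+r] : k ^ (suc t + c + r) ≡ k * (k ^ t * k ^ c * k ^ r)
    k^[1+t+c+r] = cong (k *_) (trans (^-distribˡ-+-* k (t + c) r) (cong (_* k ^ r) (^-distribˡ-+-* k t c)))
    k^[c+r]∸k^r : k ^ (c + r) ∸ k ^ r ≡ (k ^ c ∸ 1) * k ^ r
    k^[c+r]∸k^r = trans (cong₂ _∸_ (^-distribˡ-+-* k c r) (sym (*-identityˡ (k ^ r))))
                        (sym (*-distribʳ-∸ (k ^ r) (k ^ c) 1))

leafInversions≡formula1 : ∀ k n .{{_ : NonZero k}} (w : Permutation′ n) → leafInversions k n w ≡ formula1 k n w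
leafInversions≡formula1 k zero    w = sym (*-zeroʳ (k C 2))
leafInversions≡formula1 k (suc n) w = begin
  leafInversions k (suc n) w
    ≡⟨ leafInversions-suc ⟩
  k * leafInversions k n w′ + (A C 2) * (K * (K * (k C 2)))
    ≡⟨ cong (λ z → k * z + (A C 2) * (K * (K * (k C 2)))) (leafInversions≡formula1 k n w′) ⟩
  k * ((k C 2) * S′) + (A C 2) * (K * (K * (k C 2)))
    ≡⟨ regroup k (k C 2) S′ (A C 2) K ⟩
  (k C 2) * ((A C 2) * (K * K) + k * S′)
    ≡⟨ cong ((k C 2) *_) (sum-term-suc k w) ⟨
  formula1 k (suc n) w ∎
  where
  open ≡-Reasoning
  open FirstLayer k w
  S′ = sum (tabulate (term k w′))
  regroup : ∀ k c S a K → k * (c * S) + a * (K * (K * c)) ≡ c * (a * (K * K) + k * S)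
  regroup = solve-∀

4*formula1≡formula2 : ∀ k n (w : Permutation′ n) → 4 * formula1 k n w ≡ k ^ n * (k ∸ 1) * innerSum2 k n w
4*formula1≡formula2 k n w = begin
  4 * ((k C 2) * sum (tabulate (term k w)))
    ≡⟨ *-assoc 4 (k C 2) _ ⟨
  4 * (k C 2) * sum (tabulate (term k w))
    ≡⟨ sum-tabulate-* (4 * (k C 2)) (term k w) ⟨
  sum (tabulate (λ i → 4 * (k C 2) * term k w i))
    ≡⟨ cong sum (tabulate-cong (4*kC2*term k w)) ⟩
  sum (tabulate (λ i → k ^ n * (k ∸ 1) * gap i))
    ≡⟨ sum-tabulate-* (k ^ n * (k ∸ 1)) gap ⟩
  k ^ n * (k ∸ 1) * innerSum2 k n w ∎
  where
  open ≡-Reasoning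
  gap : Fin n → ℕ
  gap i = k ^ (n ∸ suc (toℕ i)) ∸ k ^ (n ∸ suc (toℕ i) ∸ lehmer w i)

theorem4p2 : (k n : ℕ) → (hk : 2 ≤ k) → (w : Permutation′ n) →
    (I k n {{nz≥2 hk}} w ≡ formula1 k n w)
    × (4 * I k n {{nz≥2 hk}} w ≡ k ^ n * (k ∸ 1) * innerSum2 k n w)
theorem4p2 k n hk w = I≡formula1 , trans (cong (4 *_) I≡formula1) (4*formula1≡formula2 k n w)
  where
  instance _ = nz≥2 hk
  I≡formula1 : I k n w ≡ formula1 k n w
  I≡formula1 = trans (I≡leafInversions k n w) (leafInversions≡formula1 k n w)
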